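{- There exists an infinite family of strings $w$, with lengths $n=|w|$ unbounded over the family, such that $z(w^R)-z(w)=\frac{n+2}{6}-1$ for every $w$ in the family (in particular $\Theta(n)$). The same holds with $z$ replaced by each of $z_{no}$, $z_e$ and $z_{end}$.
   Context: For $w=w[1]\cdots w[n]$, $w^R=w[n]\cdots w[1]$. The Lempel–Ziv parse of $w$ is the factorization $w=x_1\cdots x_z$ in which each phrase $x_j$ is the longest prefix of $x_j\cdots x_z$ having another occurrence in $w$ starting at a position $i\le|x_1\cdots x_{j-1}|$ (overlaps allowed), or, if no nonempty such prefix exists, a single character; $z(w)$ is its number of phrases. $z_{no}(w)$ is the number of phrases of the analogous greedy parse where the source occurrence must lie entirely within $x_1\cdots x_{j-1}$ (no overlap with the phrase). $z_e(w)$ is the number of phrases of the greedy LZ-end parse, where each phrase $x_j$ is the longest prefix of the remaining suffix that is a suffix of $x_1\cdots x_q$ for some $q<j$ (i.e., has an earlier occurrence ending exactly at the end of a previous phrase), or a single character if no nonempty such prefix exists. $z_{end}(w)$ is the minimum number of phrases over all factorizations $w=y_1\cdots y_m$ in which every phrase $y_j$ is either a single character or is a suffix of $y_1\cdots y_q$ for some $q<j$. -}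

module Defs where

open import Data.Nat using (ℕ; zero; suc; _+_; _*_; _≤_; _<_)
open import Data.List using (List; []; _∷_; _++_; length; take; drop; concat; [_]; reverse)
open import Data.Product using (Σ; ∃; ∃-syntax; _×_; _,_)
open import Data.Sum using (_⊎_)
open import Relation.Binary.PropositionalEquality using (_≡_; _≢_)
open import Relation.Nullary using (¬_)

-- Strings over the alphabet ℕ; positions are 0-indexed.
Str : Set
Str = List ℕ

OccursAt : Str → ℕ → Str → Set
OccursAt w i u = take (length u) (drop i w) ≡ u

IsPrefix : Str → Str → Set
IsPrefix u r = ∃[ t ] (r ≡ u ++ t)

IsSuffix : Str → Str → Set
IsSuffix u v = ∃[ t ] (v ≡ t ++ u)

-- A "source predicate": given the whole string w, the list of phrases
-- x₁ … x_{j-1} already produced, and a candidate nonempty phrase u,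
-- says whether u has an admissible earlier source.
SrcPred : Set₁
SrcPred = Str → List Str → Str → Set

-- LZ (overlaps allowed): occurrence starting at a position before the
-- start of the current phrase (1-indexed: i ≤ |x₁⋯x_{j-1}|).
SrcLZ : SrcPred
SrcLZ w ps u = ∃[ i ] (i < length (concat ps) × OccursAt w i u)

-- LZ without overlaps: occurrence lying entirely within x₁⋯x_{j-1}.
SrcLZno : SrcPred
SrcLZno w ps u = ∃[ i ] (i + length u ≤ length (concat ps) × OccursAt w i u)

SrcEnd : SrcPred
SrcEnd w ps u = ∃[ q ] (1 ≤ q × q ≤ length ps × IsSuffix u (concat (take q ps)))

GreedyPhrase : SrcPred → Str → List Str → Str → Str → Set
GreedyPhrase Src w ps rest x =
  (x ≢ [] × IsPrefix x rest × Src w ps x ×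
     (∀ u → u ≢ [] → IsPrefix u rest → Src w ps u → length u ≤ length x))
  ⊎
  ((∀ u → u ≢ [] → IsPrefix u rest → ¬ Src w ps u) ×
     IsPrefix x rest × length x ≡ 1)

data GreedyParse (Src : SrcPred) (w : Str) : List Str → Str → ℕ → Set where
  done : ∀ {ps} → GreedyParse Src w ps [] 0
  step : ∀ {ps rest k} (x s : Str) → rest ≡ x ++ s →
         GreedyPhrase Src w ps rest x →
         GreedyParse Src w (ps ++ [ x ]) s k →
         GreedyParse Src w ps rest (suc k)

-- z(w) = k,  z_no(w) = k,  z_e(w) = k  (the greedy parses are unique)
ZIs : Str → ℕ → Set
ZIs w k = GreedyParse SrcLZ w [] w k

ZnoIs : Str → ℕ → Set
ZnoIs w k = GreedyParse SrcLZno w [] w k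

ZeIs : Str → ℕ → Set
ZeIs w k = GreedyParse SrcEnd w [] w k

data EndFact (w : Str) : List Str → Str → ℕ → Set where
  done : ∀ {ps} → EndFact w ps [] 0
  step : ∀ {ps rest k} (y s : Str) → rest ≡ y ++ s → y ≢ [] →
         (length y ≡ 1 ⊎ SrcEnd w ps y) →
         EndFact w (ps ++ [ y ]) s k →
         EndFact w ps rest (suc k)

ZendIs : Str → ℕ → Set
ZendIs w k = EndFact w [] w k × (∀ k' → EndFact w [] w k' → k ≤ k')

-- There is a family of strings with unbounded lengths such that
-- f(w^R) - f(w) = (n+2)/6 - 1, written multiplied by 6 in ℕ:
-- 6·f(w^R) + 6 = 6·f(w) + n + 2.
GapFamily : (Str → ℕ → Set) → Set
GapFamily F = ∀ m → ∃[ w ] (m ≤ length w ×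
  ∃[ a ] ∃[ b ] (F (reverse w) a × F w b ×
    6 * a + 6 ≡ 6 * b + length w + 2))

{-# OPTIONS --safe #-}
module Submission where

-- Take w = 0 0 B₀ ⋯ B_{k-1} x_k y_k with B_j = x_j 0 x_j y_j 0 0, where all x_j, y_j are distinct
-- nonzero letters, so n = 6k + 4.  The greedy parse of w is 0|0, then x_j|0x_j|y_j|00 for each
-- block, then x_k|y_k: 4k + 4 phrases.  Its reverse is y_k x_k 0 0 G_{k-1} ⋯ G₀ with
-- G_j = y_j x_j 0 x_j 0 0, parsed as y_k|x_k|0|0, then y_j|x_j|0|x_j0|0 for each block: 5k + 4
-- phrases, because 0x_j and x_j00 occur there for the first time.  Every phrase with a source is a
-- suffix of the text parsed so far, so the three greedy parsers agree.  Finally a greedy LZ parse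
-- stays ahead of any LZ-end factorization, phrase by phrase, so z ≤ z_end ≤ z_e, and z_e = z here.

open import Defs
open import Data.Nat using (ℕ; zero; suc; _+_; _*_; _≤_; _<_; z≤n; s≤s)
open import Data.Nat.Properties
  using (≤-refl; ≤-reflexive; ≤-trans; <-≤-trans; <⇒≱; <-≤-connex; n≤1+n; m<n⇒m<1+n;
         m≤m+n; m≤n+m; m<m+n; m≤m*n; m≤n⇒∃[o]m+o≡n; +-comm; +-suc; +-identityʳ; +-monoʳ-<;
         +-cancelˡ-<)
open import Data.Nat.Tactic.RingSolver using (solve-∀)
open import Data.List using (List; []; _∷_; _++_; length; take; drop; concat; [_]; reverse)
open import Data.List.Properties
  using (++-assoc; ++-identityʳ; ++-conicalˡ; ++-conicalʳ; ++-cancelˡ; concat-++; length-++;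
         length-++-≤ˡ; length-++-≤ʳ; drop-drop; take-all; take++drop≡id; reverse-++; ∷-injective;
         ∷-injectiveˡ)
open import Data.List.Membership.Propositional using (_∈_; _∉_)
open import Data.List.Membership.Propositional.Properties using (∈-++⁺ˡ)
open import Data.List.Relation.Unary.All as All using (All; []; _∷_)
open import Data.List.Relation.Unary.All.Properties using (++⁺)
open import Data.List.Relation.Unary.Any using (here; there)
open import Data.Product using (_×_; _,_; proj₁; proj₂; ∃-syntax; ∃₂)
open import Data.Sum using (_⊎_; inj₁; inj₂)
import Data.Sum as Sum
open import Data.Unit using (⊤; tt)
open import Data.Empty using (⊥-elim)
open import Function using (_∘_; _$_)
open import Relation.Binary.PropositionalEquality
  using (_≡_; _≢_; refl; sym; trans; cong; subst; module ≡-Reasoning)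
open import Relation.Nullary using (¬_)

++-split : ∀ (a b c d : Str) → a ++ b ≡ c ++ d →
           (∃[ e ] (c ≡ a ++ e × b ≡ e ++ d)) ⊎
           (∃₂ λ x e → a ≡ c ++ x ∷ e × d ≡ x ∷ e ++ b)
++-split []      b c       d eq = inj₁ (c , refl , eq)
++-split (x ∷ a) b []      d eq = inj₂ (x , a , refl , sym eq)
++-split (x ∷ a) b (y ∷ c) d eq with ∷-injective eq
... | refl , eq′ with ++-split a b c d eq′
...   | inj₁ (e , c≡ , b≡)     = inj₁ (e , cong (x ∷_) c≡ , b≡)
...   | inj₂ (z , e , a≡ , d≡) = inj₂ (z , e , cong (x ∷_) a≡ , d≡)

length-<-++ : ∀ (t : Str) c v → length t < length (t ++ c ∷ v)
length-<-++ t c v = subst (length t <_) (sym (length-++ t)) (m<m+n (length t) (s≤s z≤n))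

++-prefix-of-longer : ∀ (u s x s′ : Str) → u ++ s ≡ x ++ s′ → length u ≤ length x →
                      ∃[ e ] (x ≡ u ++ e × s ≡ e ++ s′)
++-prefix-of-longer u s x s′ eq u≤x with ++-split u s x s′ eq
... | inj₁ (e , x≡ , s≡)       = e , x≡ , s≡
... | inj₂ (z , e , refl , _) = ⊥-elim (<⇒≱ (length-<-++ x z e) u≤x)

length-∷ʳ : ∀ (xs : Str) a → length (xs ++ [ a ]) ≡ suc (length xs)
length-∷ʳ xs a = trans (length-++ xs) (+-comm (length xs) 1)

concat-∷ʳ : ∀ (ps : List Str) x → concat (ps ++ [ x ]) ≡ concat ps ++ x
concat-∷ʳ ps x = trans (sym (concat-++ ps [ x ])) (cong (concat ps ++_) (++-identityʳ x))

length-concat-∷ʳ : ∀ (ps : List Str) x → length (concat ps) ≤ length (concat (ps ++ [ x ]))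
length-concat-∷ʳ ps x =
  subst (λ l → length (concat ps) ≤ length l) (sym (concat-∷ʳ ps x)) (length-++-≤ˡ (concat ps))

take-++-≤ : ∀ {A : Set} q (xs ys : List A) → q ≤ length xs → take q (xs ++ ys) ≡ take q xs
take-++-≤ zero    xs       ys _         = refl
take-++-≤ (suc q) (x ∷ xs) ys (s≤s q≤) = cong (x ∷_) (take-++-≤ q xs ys q≤)

take-++⁻ : ∀ (u v l : Str) → take (length (u ++ v)) l ≡ u ++ v →
           take (length u) l ≡ u × take (length v) (drop (length u) l) ≡ v
take-++⁻ []      v l       eq = refl , eq
take-++⁻ (a ∷ u) v []      ()
take-++⁻ (a ∷ u) v (b ∷ l) eq with ∷-injective eq
... | refl , eq′ with take-++⁻ u v l eq′
...   | eqᵤ , eqᵥ = cong (a ∷_) eqᵤ , eqᵥ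

take-length-++ : ∀ (u r : Str) → take (length u) (u ++ r) ≡ u
take-length-++ []      r = refl
take-length-++ (a ∷ u) r = cong (a ∷_) (take-length-++ u r)

suffix-tail : ∀ {a u p} → IsSuffix (a ∷ u) p → IsSuffix u p
suffix-tail {a} {u} (t , p≡) = t ++ [ a ] , trans p≡ (sym (++-assoc t [ a ] u))

suffix-++ : ∀ {u p} v → IsSuffix u p → IsSuffix (u ++ v) (p ++ v)
suffix-++ {u} v (t , p≡) = t , trans (cong (_++ v) p≡) (++-assoc t u v)

1≤length : ∀ {x : Str} → x ≢ [] → 1 ≤ length x
1≤length {[]}    x≢[] = ⊥-elim (x≢[] refl)
1≤length {_ ∷ _} _    = s≤s z≤n

++-∷-nonempty : ∀ (t : Str) z e → t ++ z ∷ e ≢ []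
++-∷-nonempty []      z e ()
++-∷-nonempty (_ ∷ _) z e ()

occursAt-++ : ∀ (P u r : Str) → OccursAt (P ++ u ++ r) (length P) u
occursAt-++ []      u r = take-length-++ u r
occursAt-++ (a ∷ P) u r = occursAt-++ P u r

occursAt-suffix : ∀ {W P rest} t u → W ≡ P ++ rest → P ≡ t ++ u → OccursAt W (length t) u
occursAt-suffix {rest = rest} t u refl refl =
  subst (λ W → OccursAt W (length t) u) (sym (++-assoc t u rest)) (occursAt-++ t u rest)

occursAt-++⁻ : ∀ {W i} u v → OccursAt W i (u ++ v) → OccursAt W i u × OccursAt W (length u + i) v
occursAt-++⁻ {W} {i} u v occ with take-++⁻ u v (drop i W) occ
... | occᵤ , occᵥ =
  occᵤ , subst (λ l → take (length v) l ≡ v)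
                (trans (drop-drop i (length u) W) (cong (λ n → drop n W) (+-comm i (length u)))) occᵥ

occursAt-drop : ∀ (P : Str) {S} d u → OccursAt (P ++ S) (length P + d) u → OccursAt S d u
occursAt-drop []      d u occ = occ
occursAt-drop (a ∷ P) d u occ = occursAt-drop P d u occ

occursAt⇒∈ : ∀ {W} P {S i c v} → W ≡ P ++ S → i < length P → OccursAt W i (c ∷ v) → c ∈ P
occursAt⇒∈ (a ∷ P) {i = zero}  refl _         occ = here (sym (∷-injectiveˡ occ))
occursAt⇒∈ (a ∷ P) {i = suc i} refl (s≤s i<) occ = there (occursAt⇒∈ P refl i< occ)

no-occurrence-before : ∀ {W P S u} k → W ≡ P ++ S →
                       (∀ i → i < length P → ¬ OccursAt W i u) → (∀ d → d < k → ¬ OccursAt S d u) →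
                       ∀ i → i < k + length P → ¬ OccursAt W i u
no-occurrence-before {P = P} k refl inside window i i< occ with <-≤-connex i (length P)
... | inj₁ i<P = inside i i<P occ
... | inj₂ P≤i with m≤n⇒∃[o]m+o≡n P≤i
...   | d , refl =
  window d (+-cancelˡ-< (length P) d k (subst (length P + d <_) (+-comm k (length P)) i<))
           (occursAt-drop P d _ occ)

record IsLZLike (Src : SrcPred) : Set where
  field
    toLZ       : ∀ {W ps rest u} → W ≡ concat ps ++ rest → u ≢ [] → Src W ps u → SrcLZ W ps u
    extend     : ∀ {W ps u} x → Src W ps u → Src W (ps ++ [ x ]) u
    fromSuffix : ∀ {W ps rest u} → W ≡ concat ps ++ rest → u ≢ [] → IsSuffix u (concat ps) →
                 Src W ps u

lzLZ : IsLZLike SrcLZ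
lzLZ = record
  { toLZ       = λ _ _ src → src
  ; extend     = λ { {ps = ps} x (i , i< , occ) → i , <-≤-trans i< (length-concat-∷ʳ ps x) , occ }
  ; fromSuffix = λ { {u = []} _ u≢[] _ → ⊥-elim (u≢[] refl)
                   ; {u = c ∷ v} W≡ _ (t , ps≡) →
                       length t , subst (length t <_) (cong length (sym ps≡)) (length-<-++ t c v) ,
                       occursAt-suffix t (c ∷ v) W≡ ps≡ }
  }

lzLZno : IsLZLike SrcLZno
lzLZno = record
  { toLZ       = λ { {u = []} _ u≢[] _ → ⊥-elim (u≢[] refl)
                   ; {u = c ∷ v} _ _ (i , i+u≤ , occ) →
                       i , <-≤-trans (m<m+n i (s≤s z≤n)) i+u≤ , occ }
  ; extend     = λ { {ps = ps} x (i , i+u≤ , occ) →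
                       i , ≤-trans i+u≤ (length-concat-∷ʳ ps x) , occ }
  ; fromSuffix = λ { {u = u} W≡ _ (t , ps≡) →
                       length t , ≤-reflexive (sym (trans (cong length ps≡) (length-++ t))) ,
                       occursAt-suffix t u W≡ ps≡ }
  }

lzEnd : IsLZLike SrcEnd
lzEnd = record
  { toLZ       = toLZ
  ; extend     = λ { {ps = ps} {u} x (q , 1≤q , q≤ , suf) →
                       q , 1≤q , ≤-trans q≤ (length-++-≤ˡ ps) ,
                       subst (λ qs → IsSuffix u (concat qs)) (sym (take-++-≤ q ps [ x ] q≤)) suf }
  ; fromSuffix = fromSuffix
  }
  where
  toLZ : ∀ {W ps rest u} → W ≡ concat ps ++ rest → u ≢ [] → SrcEnd W ps u → SrcLZ W ps u
  toLZ {u = []} _ u≢[] _ = ⊥-elim (u≢[] refl)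
  toLZ {W} {ps} {rest} {c ∷ v} W≡ _ (q , _ , _ , t , taken≡) =
    length t ,
    <-≤-trans (length-<-++ t c v)
              (subst (λ l → length (t ++ c ∷ v) ≤ length l) ps≡ (length-++-≤ˡ (t ++ c ∷ v))) ,
    occursAt-suffix t (c ∷ v) W≡′ refl
    where
    dropped = concat (drop q ps)
    ps≡ : (t ++ c ∷ v) ++ dropped ≡ concat ps
    ps≡ = trans (cong (_++ dropped) (sym taken≡))
                (trans (concat-++ (take q ps) (drop q ps)) (cong concat (take++drop≡id q ps)))
    W≡′ : W ≡ (t ++ c ∷ v) ++ dropped ++ rest
    W≡′ = trans W≡ (trans (cong (_++ rest) (sym ps≡)) (++-assoc (t ++ c ∷ v) dropped rest))
  fromSuffix : ∀ {W ps rest u} → W ≡ concat ps ++ rest → u ≢ [] → IsSuffix u (concat ps) →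
               SrcEnd W ps u
  fromSuffix {ps = []} {u = u} _ u≢[] (t , []≡) = ⊥-elim (u≢[] (++-conicalʳ t u (sym []≡)))
  fromSuffix {ps = p ∷ ps} {u = u} _ _ suf =
    length (p ∷ ps) , s≤s z≤n , ≤-refl ,
    subst (λ qs → IsSuffix u (concat qs)) (sym (take-all _ (p ∷ ps) ≤-refl)) suf

-- Greedy parsing

record Cursor (W : Str) (ps : List Str) (pre rest : Str) : Set where
  constructor cursor
  field
    concat≡ : concat ps ≡ pre
    split≡  : W ≡ pre ++ rest

advance : ∀ {W ps pre} x {r} → Cursor W ps pre (x ++ r) → Cursor W (ps ++ [ x ]) (pre ++ x) r
advance {ps = ps} {pre} x {r} (cursor refl W≡) =
  cursor (concat-∷ʳ ps x) (trans W≡ (sym (++-assoc pre x r)))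

Blocked : Str → ℕ → Str → Str → Set
Blocked W L x []      = ⊤
Blocked W L x (c ∷ _) = ∀ i → i < L → ¬ OccursAt W i (x ++ [ c ])

HeadFresh : Str → Str → Set
HeadFresh P []      = ⊤
HeadFresh P (c ∷ _) = c ∉ P

blocked-by-fresh : ∀ {W ps pre} x r → Cursor W ps pre (x ++ r) → HeadFresh (pre ++ x) r →
                   Blocked W (length pre) x r
blocked-by-fresh x []      _             _  = tt
blocked-by-fresh {pre = pre} x (c ∷ r) (cursor _ W≡) c∉ i i< occ =
  c∉ (occursAt⇒∈ (pre ++ x) (trans W≡ (sym (++-assoc pre x (c ∷ r)))) bound
                  (proj₂ (occursAt-++⁻ {i = i} x [ c ] occ)))
  where
  bound : length x + i < length (pre ++ x)
  bound = subst (length x + i <_) (trans (+-comm (length x) (length pre)) (sym (length-++ pre)))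
                (+-monoʳ-< (length x) i<)

module GreedySteps {Src : SrcPred} (lz : IsLZLike Src) where
  open IsLZLike lz

  source-of-suffix : ∀ {W ps pre rest u} → Cursor W ps pre rest → u ≢ [] → IsSuffix u pre →
                     Src W ps u
  source-of-suffix (cursor refl W≡) = fromSuffix W≡

  fresh-step : ∀ {W ps pre c r k} → Cursor W ps pre (c ∷ r) → c ∉ pre →
               GreedyParse Src W (ps ++ [ [ c ] ]) r k → GreedyParse Src W ps (c ∷ r) (suc k)
  fresh-step {W} {ps} {c = c} {r} (cursor refl W≡) c∉ =
    step [ c ] r refl (inj₂ (no-source , (r , refl) , refl))
    where
    no-source : ∀ u → u ≢ [] → IsPrefix u (c ∷ r) → ¬ Src W ps u
    no-source []      u≢[] _       _   = u≢[] refl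
    no-source (a ∷ v) u≢[] (t , eq) src with toLZ W≡ u≢[] src | ∷-injectiveˡ eq
    ... | i , i< , occ | refl = c∉ (occursAt⇒∈ (concat ps) W≡ i< occ)

  source-step : ∀ {W ps pre r k} x → Cursor W ps pre (x ++ r) → x ≢ [] → Src W ps x →
                Blocked W (length pre) x r →
                GreedyParse Src W (ps ++ [ x ]) r k → GreedyParse Src W ps (x ++ r) (suc k)
  source-step {W} {ps} {r = r} x (cursor refl W≡) x≢[] src blocked =
    step x r refl (inj₁ (x≢[] , (r , refl) , src , longest))
    where
    longest : ∀ u → u ≢ [] → IsPrefix u (x ++ r) → Src W ps u → length u ≤ length x
    longest u u≢[] (t , eq) srcᵤ with ++-split u t x r (sym eq)
    ... | inj₁ (e , x≡ , _) = subst (λ x → length u ≤ length x) (sym x≡) (length-++-≤ˡ u)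
    ... | inj₂ (c , e , refl , r≡) with toLZ W≡ u≢[] srcᵤ
    ...   | i , i< , occ =
      ⊥-elim $ subst (Blocked W _ x) r≡ blocked i i< $
        proj₁ (occursAt-++⁻ {W} {i} (x ++ [ c ]) e (subst (OccursAt W i) (sym (++-assoc x [ c ] e)) occ))

-- Greedy LZ parses and LZ-end factorizations

phrase-nonempty : ∀ {Src W ps rest x} → GreedyPhrase Src W ps rest x → x ≢ []
phrase-nonempty (inj₁ (x≢[] , _)) = x≢[]
phrase-nonempty (inj₂ (_ , _ , ())) refl

greedy-phrase-longest : ∀ {W ps rest x u} → GreedyPhrase SrcLZ W ps rest x → u ≢ [] →
                        IsPrefix u rest → length u ≤ 1 ⊎ SrcLZ W ps u → length u ≤ length x
greedy-phrase-longest (inj₁ (x≢[] , _))   _ _ (inj₁ u≤1) = ≤-trans u≤1 (1≤length x≢[])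
greedy-phrase-longest (inj₂ (_ , _ , x≡1)) _ _ (inj₁ u≤1) = subst (_ ≤_) (sym x≡1) u≤1
greedy-phrase-longest (inj₁ (_ , _ , _ , longest)) u≢[] pre (inj₂ src) = longest _ u≢[] pre src
greedy-phrase-longest (inj₂ (none , _))            u≢[] pre (inj₂ src) = ⊥-elim (none _ u≢[] pre src)

lz-source-drop : ∀ {W ps qs} t u → concat ps ≡ concat qs ++ t → SrcLZ W qs (t ++ u) → SrcLZ W ps u
lz-source-drop {W} {ps} {qs} t u ps≡ (i , i< , occ) =
  length t + i , bound , proj₂ (occursAt-++⁻ {W} {i} t u occ)
  where
  bound : length t + i < length (concat ps)
  bound = subst (length t + i <_)
                (trans (+-comm (length t) _) (sym (trans (cong length ps≡) (length-++ (concat qs)))))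
                (+-monoʳ-< (length t) i<)

remaining-suffix : ∀ {W ps qs P Q t rest r} → Cursor W ps P rest → Cursor W qs Q r → P ≡ Q ++ t →
                   r ≡ t ++ rest
remaining-suffix {Q = Q} {t} {rest} {r} (cursor _ W≡P) (cursor _ W≡Q) refl =
  ++-cancelˡ Q r (t ++ rest) (trans (sym W≡Q) (trans W≡P (++-assoc Q t rest)))

-- If y reached past x, the part of y after P would be a prefix longer than x with an LZ source,
-- namely the shifted source of y.
lz-end-phrase-within-greedy : ∀ {W ps qs P Q t x s′ y s} →
  Cursor W ps P (x ++ s′) → Cursor W qs Q (y ++ s) → P ≡ Q ++ t →
  GreedyPhrase SrcLZ W ps (x ++ s′) x → length y ≡ 1 ⊎ SrcEnd W qs y →
  ∃[ t′ ] (t ++ x ≡ y ++ t′ × s ≡ t′ ++ s′)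
lz-end-phrase-within-greedy {W} {ps} {qs} {t = t} {x} {s′} {y} {s}
                            cᵖ@(cursor refl _) cᵠ@(cursor refl W≡) P≡ phrase src
  with ++-split y s t (x ++ s′) (remaining-suffix cᵖ cᵠ P≡)
... | inj₁ (e , t≡ , s≡) =
  e ++ x , trans (cong (_++ x) t≡) (++-assoc y e x) , trans s≡ (sym (++-assoc e x s′))
... | inj₂ (z , e , refl , xs′≡) with ++-prefix-of-longer (z ∷ e) s x s′ (sym xs′≡) u≤x
  where
  short : length (t ++ z ∷ e) ≡ 1 → length (z ∷ e) ≤ 1
  short y≡1 = subst (length (z ∷ e) ≤_) y≡1 (length-++-≤ʳ (z ∷ e) {t})
  shifted : SrcEnd W qs (t ++ z ∷ e) → SrcLZ W ps (z ∷ e)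
  shifted = lz-source-drop {W} {ps} {qs} t (z ∷ e) P≡ ∘ IsLZLike.toLZ lzEnd W≡ (++-∷-nonempty t z e)
  u≤x : length (z ∷ e) ≤ length x
  u≤x = greedy-phrase-longest {W} {ps} phrase (λ ()) (s , xs′≡) (Sum.map short shifted src)
... | e′ , refl , s≡ = e′ , sym (++-assoc t (z ∷ e) e′) , s≡

-- The greedy parse stays ahead: it has consumed P = Q ++ t while the factorization has consumed Q.
greedy-LZ≤EndFact : ∀ {W ps qs P Q t rest r k k′} →
                    Cursor W ps P rest → Cursor W qs Q r → P ≡ Q ++ t →
                    GreedyParse SrcLZ W ps rest k → EndFact W qs r k′ → k ≤ k′
greedy-LZ≤EndFact _ _ _ done _ = z≤n
greedy-LZ≤EndFact {W} {ps} {t = t} cᵖ cᵠ P≡ (step x s′ refl phrase _) done =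
  ⊥-elim (phrase-nonempty {SrcLZ} {W} {ps} phrase
           (++-conicalˡ x s′ (++-conicalʳ t (x ++ s′) (sym (remaining-suffix cᵖ cᵠ P≡)))))
greedy-LZ≤EndFact {P = P} {Q} {t} cᵖ cᵠ P≡ (step x s′ refl phrase gp) (step y s refl _ src ef)
  with lz-end-phrase-within-greedy cᵖ cᵠ P≡ phrase src
... | t′ , tx≡ , _ = s≤s (greedy-LZ≤EndFact (advance x cᵖ) (advance y cᵠ) P′≡ gp ef)
  where
  open ≡-Reasoning
  P′≡ : P ++ x ≡ (Q ++ y) ++ t′
  P′≡ = begin
    P ++ x          ≡⟨ cong (_++ x) P≡ ⟩
    (Q ++ t) ++ x   ≡⟨ ++-assoc Q t x ⟩
    Q ++ (t ++ x)   ≡⟨ cong (Q ++_) tx≡ ⟩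
    Q ++ (y ++ t′)  ≡⟨ sym (++-assoc Q y t′) ⟩
    (Q ++ y) ++ t′  ∎

greedy-LZ-end⇒EndFact : ∀ {W ps rest k} → GreedyParse SrcEnd W ps rest k → EndFact W ps rest k
greedy-LZ-end⇒EndFact done = done
greedy-LZ-end⇒EndFact {W} {ps} (step x s rest≡ phrase gp) =
  step x s rest≡ (phrase-nonempty {SrcEnd} {W} {ps} phrase) (letter-or-source phrase)
       (greedy-LZ-end⇒EndFact gp)
  where
  letter-or-source : ∀ {rest} → GreedyPhrase SrcEnd W ps rest x → length x ≡ 1 ⊎ SrcEnd W ps x
  letter-or-source (inj₁ (_ , _ , src , _)) = inj₂ src
  letter-or-source (inj₂ (_ , _ , x≡1))     = inj₁ x≡1

zend-from-greedy : ∀ {w k} → ZeIs w k → ZIs w k → ZendIs w k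
zend-from-greedy ze z =
  greedy-LZ-end⇒EndFact ze , λ _ → greedy-LZ≤EndFact (cursor refl refl) (cursor refl refl) refl z

-- The family

-- x_j = 2j + 1 and y_j = 2j + 2, so that x_j < y_j < x_{j+1} hold by ≤-refl.
X Y : ℕ → ℕ
X j = suc (j * 2)
Y j = suc (X j)

B G : ℕ → Str
B j = X j ∷ 0 ∷ X j ∷ Y j ∷ 0 ∷ 0 ∷ []
G j = Y j ∷ X j ∷ 0 ∷ X j ∷ 0 ∷ 0 ∷ []

Blocks : ℕ → ℕ → Str
Blocks j zero    = X j ∷ Y j ∷ []
Blocks j (suc m) = B j ++ Blocks (suc j) m

RevBlocks : ℕ → Str
RevBlocks zero    = []
RevBlocks (suc n) = G n ++ RevBlocks n

word revWord : ℕ → Str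
word k    = 0 ∷ 0 ∷ Blocks 0 k
revWord k = Y k ∷ X k ∷ 0 ∷ 0 ∷ RevBlocks k

reverse-Blocks : ∀ j m → reverse (Blocks j m) ++ 0 ∷ 0 ∷ RevBlocks j ≡ revWord (m + j)
reverse-Blocks j zero    = refl
reverse-Blocks j (suc m) = begin
  reverse (B j ++ Blocks (suc j) m) ++ 0 ∷ 0 ∷ RevBlocks j
    ≡⟨ cong (_++ 0 ∷ 0 ∷ RevBlocks j) (reverse-++ (B j) (Blocks (suc j) m)) ⟩
  (reverse (Blocks (suc j) m) ++ reverse (B j)) ++ 0 ∷ 0 ∷ RevBlocks j
    ≡⟨ ++-assoc (reverse (Blocks (suc j) m)) (reverse (B j)) _ ⟩
  reverse (Blocks (suc j) m) ++ 0 ∷ 0 ∷ RevBlocks (suc j)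
    ≡⟨ reverse-Blocks (suc j) m ⟩
  revWord (m + suc j)
    ≡⟨ cong revWord (+-suc m j) ⟩
  revWord (suc m + j) ∎
  where open ≡-Reasoning

reverse-word : ∀ k → reverse (word k) ≡ revWord k
reverse-word k = begin
  reverse ((0 ∷ 0 ∷ []) ++ Blocks 0 k)    ≡⟨ reverse-++ (0 ∷ 0 ∷ []) (Blocks 0 k) ⟩
  reverse (Blocks 0 k) ++ 0 ∷ 0 ∷ []      ≡⟨ reverse-Blocks 0 k ⟩
  revWord (k + 0)                         ≡⟨ cong revWord (+-identityʳ k) ⟩
  revWord k                               ∎
  where open ≡-Reasoning

length-Blocks : ∀ j m → length (Blocks j m) ≡ m * 6 + 2
length-Blocks j zero    = refl
length-Blocks j (suc m) = cong (6 +_) (length-Blocks (suc j) m)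

ZeroOr≥ : ℕ → ℕ → Set
ZeroOr≥ t a = a ≡ 0 ⊎ t ≤ a

All<⇒∉ : ∀ {t c l} → All (_< t) l → t ≤ c → c ∉ l
All<⇒∉ below t≤c c∈ = <⇒≱ (All.lookup below c∈) t≤c

AllZeroOr≥⇒∉ : ∀ {t c l} → All (ZeroOr≥ t) l → c ≢ 0 → c < t → c ∉ l
AllZeroOr≥⇒∉ outside c≢0 c<t c∈ = Sum.[ c≢0 , <⇒≱ c<t ] (All.lookup outside c∈)

Blocks-head-fresh : ∀ j m {P} → All (_< X j) P → HeadFresh P (Blocks j m)
Blocks-head-fresh j zero    below = All<⇒∉ below ≤-refl
Blocks-head-fresh j (suc m) below = All<⇒∉ below ≤-refl

RevBlocks-head-fresh : ∀ n {P} → All (ZeroOr≥ (X n)) P → HeadFresh P (RevBlocks n)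
RevBlocks-head-fresh zero    _       = tt
RevBlocks-head-fresh (suc n) outside = AllZeroOr≥⇒∉ outside (λ ()) ≤-refl

new-0X-in-G : ∀ n {W pre R} → W ≡ pre ++ G n ++ R → X n ∉ pre ++ [ Y n ] →
              ∀ i → i < 2 + length pre → ¬ OccursAt W i (0 ∷ X n ∷ [])
new-0X-in-G n {W} {pre} W≡ x∉ = no-occurrence-before 2 W≡ inside window
  where
  inside : ∀ i → i < length pre → ¬ OccursAt W i (0 ∷ X n ∷ [])
  inside i i< occ = x∉ (occursAt⇒∈ (pre ++ [ Y n ]) (trans W≡ (sym (++-assoc pre [ Y n ] _)))
                          (subst (suc i <_) (sym (length-∷ʳ pre (Y n))) (s≤s i<))
                          (proj₂ (occursAt-++⁻ {W} {i} [ 0 ] [ X n ] occ)))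
  window : ∀ {R} d → d < 2 → ¬ OccursAt (G n ++ R) d (0 ∷ X n ∷ [])
  window 0 _ ()
  window 1 _ ()
  window (suc (suc _)) (s≤s (s≤s ()))

new-X00-in-G : ∀ n {W pre R} → W ≡ pre ++ G n ++ R → X n ∉ pre →
               ∀ i → i < 3 + length pre → ¬ OccursAt W i (X n ∷ 0 ∷ 0 ∷ [])
new-X00-in-G n W≡ x∉ = no-occurrence-before 3 W≡ (λ i i< → x∉ ∘ occursAt⇒∈ _ W≡ i<) window
  where
  window : ∀ {R} d → d < 3 → ¬ OccursAt (G n ++ R) d (X n ∷ 0 ∷ 0 ∷ [])
  window 0 _ ()
  window 1 _ ()
  window 2 _ ()
  window (suc (suc (suc _))) (s≤s (s≤s (s≤s ())))

module _ {Src : SrcPred} (lz : IsLZLike Src) where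
  open IsLZLike lz
  open GreedySteps lz

  parse-Blocks : ∀ j m {W ps pre} → Cursor W ps pre (Blocks j m) → All (_< X j) pre →
                 IsSuffix (0 ∷ 0 ∷ []) pre → GreedyParse Src W ps (Blocks j m) (m * 4 + 2)
  parse-Blocks j zero cur below _ =
    fresh-step cur (All<⇒∉ below ≤-refl) $
    fresh-step (advance [ X j ] cur) (All<⇒∉ (++⁺ (All.map m<n⇒m<1+n below) (≤-refl ∷ [])) ≤-refl)
    done
  parse-Blocks j (suc m) {W} {ps} {pre} cur below ends =
    fresh-step cur (All<⇒∉ below ≤-refl) $
    source-step (0 ∷ x ∷ []) cur₁ (λ ())
      (source-of-suffix cur₁ (λ ()) (suffix-++ [ x ] (suffix-tail ends)))
      (blocked-by-fresh (0 ∷ x ∷ []) _ cur₁ (All<⇒∉ below₂ ≤-refl)) $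
    fresh-step cur₂ (All<⇒∉ below₂ ≤-refl) $
    source-step (0 ∷ 0 ∷ []) cur₃ (λ ())
      (extend [ y ] (extend (0 ∷ x ∷ []) (extend [ x ] (source-of-suffix cur (λ ()) ends))))
      (blocked-by-fresh (0 ∷ 0 ∷ []) _ cur₃ (Blocks-head-fresh (suc j) m below₄)) $
    parse-Blocks (suc j) m (advance (0 ∷ 0 ∷ []) cur₃) below₄ (_ , refl)
    where
    x = X j
    y = Y j
    cur₁ = advance [ x ] cur
    cur₂ = advance (0 ∷ x ∷ []) cur₁
    cur₃ = advance [ y ] cur₂
    below₂ : All (_< y) ((pre ++ [ x ]) ++ (0 ∷ x ∷ []))
    below₂ = ++⁺ (++⁺ (All.map m<n⇒m<1+n below) (≤-refl ∷ [])) (s≤s z≤n ∷ ≤-refl ∷ [])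
    below₄ : All (_< X (suc j)) ((((pre ++ [ x ]) ++ (0 ∷ x ∷ [])) ++ [ y ]) ++ (0 ∷ 0 ∷ []))
    below₄ = ++⁺ (++⁺ (All.map m<n⇒m<1+n below₂) (≤-refl ∷ [])) (s≤s z≤n ∷ s≤s z≤n ∷ [])

  parse-word : ∀ k → GreedyParse Src (word k) [] (word k) (2 + (k * 4 + 2))
  parse-word k =
    fresh-step cur₀ (λ ()) $
    source-step [ 0 ] cur₁ (λ ()) (source-of-suffix cur₁ (λ ()) ([] , refl))
      (blocked-by-fresh [ 0 ] (Blocks 0 k) cur₁ (Blocks-head-fresh 0 k below)) $
    parse-Blocks 0 k (advance [ 0 ] cur₁) below ([] , refl)
    where
    cur₀ : Cursor (word k) [] [] (word k)
    cur₀ = cursor refl refl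
    cur₁ = advance [ 0 ] cur₀
    below : All (_< X 0) (0 ∷ 0 ∷ [])
    below = s≤s z≤n ∷ s≤s z≤n ∷ []

  parse-RevBlocks : ∀ n {W ps pre} → Cursor W ps pre (RevBlocks n) → All (ZeroOr≥ (X n)) pre →
                    IsSuffix (0 ∷ 0 ∷ []) pre → GreedyParse Src W ps (RevBlocks n) (n * 5)
  parse-RevBlocks zero    _ _ _ = done
  parse-RevBlocks (suc n) {W} {ps} {pre} cur outside ends =
    fresh-step cur (AllZeroOr≥⇒∉ outside (λ ()) ≤-refl) $
    fresh-step cur₁ x∉pre₁ $
    source-step [ 0 ] cur₂ (λ ())
      (extend [ x ] (extend [ y ] (source-of-suffix cur (λ ()) (suffix-tail ends)))) blocked₂ $
    source-step (x ∷ 0 ∷ []) cur₃ (λ ())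
      (source-of-suffix cur₃ (λ ()) (suffix-++ {[ x ]} [ 0 ] (pre₁ , refl))) blocked₃ $
    source-step [ 0 ] cur₄ (λ ()) (source-of-suffix cur₄ (λ ()) ends-0)
      (blocked-by-fresh [ 0 ] (RevBlocks n) cur₄ (RevBlocks-head-fresh n outside₅)) $
    parse-RevBlocks n (advance [ 0 ] cur₄) outside₅ (suffix-++ [ 0 ] ends-0)
    where
    x = X n
    y = Y n
    pre₁ = pre ++ [ y ]
    pre₂ = pre₁ ++ [ x ]
    pre₃ = pre₂ ++ [ 0 ]
    pre₄ = pre₃ ++ (x ∷ 0 ∷ [])
    cur₁ = advance [ y ] cur
    cur₂ = advance [ x ] cur₁
    cur₃ = advance [ 0 ] cur₂
    cur₄ = advance (x ∷ 0 ∷ []) cur₃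
    ends-0 : IsSuffix [ 0 ] pre₄
    ends-0 = suffix-tail (pre₃ , refl)
    outside₁ : All (ZeroOr≥ y) pre₁
    outside₁ = ++⁺ (All.map (Sum.map₂ (≤-trans (n≤1+n y))) outside) (inj₂ ≤-refl ∷ [])
    outside₅ : All (ZeroOr≥ x) (pre₄ ++ [ 0 ])
    outside₅ = ++⁺ (++⁺ (++⁺ (++⁺ (All.map (Sum.map₂ (≤-trans (n≤1+n x))) outside₁)
                                  (inj₂ ≤-refl ∷ []))
                             (inj₁ refl ∷ []))
                        (inj₂ ≤-refl ∷ inj₁ refl ∷ []))
                   (inj₁ refl ∷ [])
    x∉pre₁ : x ∉ pre₁
    x∉pre₁ = AllZeroOr≥⇒∉ outside₁ (λ ()) ≤-refl
    length-pre₂ : length pre₂ ≡ 2 + length pre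
    length-pre₂ = trans (length-∷ʳ pre₁ x) (cong suc (length-∷ʳ pre y))
    blocked₂ : Blocked W (length pre₂) [ 0 ] (x ∷ 0 ∷ 0 ∷ RevBlocks n)
    blocked₂ i i< = new-0X-in-G n (Cursor.split≡ cur) x∉pre₁ i (subst (i <_) length-pre₂ i<)
    blocked₃ : Blocked W (length pre₃) (x ∷ 0 ∷ []) (0 ∷ RevBlocks n)
    blocked₃ i i< = new-X00-in-G n (Cursor.split≡ cur) (x∉pre₁ ∘ ∈-++⁺ˡ) i
                      (subst (i <_) (trans (length-∷ʳ pre₂ 0) (cong suc length-pre₂)) i<)

  parse-revWord : ∀ k → GreedyParse Src (revWord k) [] (revWord k) (4 + k * 5)
  parse-revWord k =
    fresh-step cur₀ (λ ()) $
    fresh-step cur₁ (AllZeroOr≥⇒∉ (inj₂ ≤-refl ∷ []) (λ ()) ≤-refl) $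
    fresh-step cur₂ (λ { (here ()) ; (there (here ())) ; (there (there ())) }) $
    source-step [ 0 ] cur₃ (λ ()) (source-of-suffix cur₃ (λ ()) (Y k ∷ X k ∷ [] , refl))
      (blocked-by-fresh [ 0 ] (RevBlocks k) cur₃ (RevBlocks-head-fresh k outside)) $
    parse-RevBlocks k (advance [ 0 ] cur₃) outside (Y k ∷ X k ∷ [] , refl)
    where
    cur₀ : Cursor (revWord k) [] [] (revWord k)
    cur₀ = cursor refl refl
    cur₁ = advance [ Y k ] cur₀
    cur₂ = advance [ X k ] cur₁
    cur₃ = advance [ 0 ] cur₂
    outside : All (ZeroOr≥ (X k)) (Y k ∷ X k ∷ 0 ∷ 0 ∷ [])
    outside = inj₂ (n≤1+n _) ∷ inj₂ ≤-refl ∷ inj₁ refl ∷ inj₁ refl ∷ []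

gap-arithmetic : ∀ k → 6 * (4 + k * 5) + 6 ≡ 6 * (2 + (k * 4 + 2)) + (2 + (k * 6 + 2)) + 2
gap-arithmetic = solve-∀

length-word : ∀ k → length (word k) ≡ 2 + (k * 6 + 2)
length-word k = cong (2 +_) (length-Blocks 0 k)

gap-family : ∀ {F : Str → ℕ → Set} →
             (∀ k → F (word k) (2 + (k * 4 + 2))) → (∀ k → F (revWord k) (4 + k * 5)) → GapFamily F
gap-family {F} forward backward k =
  word k , k≤n , 4 + k * 5 , 2 + (k * 4 + 2) ,
  subst (λ w → F w (4 + k * 5)) (sym (reverse-word k)) (backward k) , forward k ,
  trans (gap-arithmetic k) (cong (λ n → 6 * (2 + (k * 4 + 2)) + n + 2) (sym (length-word k)))
  where
  k≤n : k ≤ length (word k)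
  k≤n = subst (k ≤_) (sym (length-word k)) (≤-trans (m≤m*n k 6) (≤-trans (m≤m+n _ 2) (m≤n+m _ 2)))

proposition4p10 : GapFamily ZIs × GapFamily ZnoIs × GapFamily ZeIs × GapFamily ZendIs
proposition4p10 =
  gap-family (parse-word lzLZ) (parse-revWord lzLZ) ,
  gap-family (parse-word lzLZno) (parse-revWord lzLZno) ,
  gap-family (parse-word lzEnd) (parse-revWord lzEnd) ,
  gap-family (λ k → zend-from-greedy (parse-word lzEnd k) (parse-word lzLZ k))
             (λ k → zend-from-greedy (parse-revWord lzEnd k) (parse-revWord lzLZ k))
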